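{- Let $\mathbb{V}$ be a finite dimensional vector space over a field $\mathbb{F}$ and $\mathcal{K}=\{+\}\cup\{f_r:r\in\mathbb{F},r\neq0\}$, where $f_r(v)=r\cdot v$. Then $(\mathbb{V},\mathcal{K})$ is a Ramsey algebra.
   Context: Orderly terms $\mathrm{OT}(\mathcal{K})$: smallest collection containing $\mathcal{K}$ and $\mathrm{id}_\mathbb{V}$, closed under $f(\bar x_1,\dots,\bar x_k)=g(h_1(\bar x_1),\dots,h_k(\bar x_k))$ for $k$-ary $g\in\mathcal{K}$, orderly terms $h_i$, consecutive disjoint variable blocks $\bar x_i$. For $\vec a,\vec b\in{}^\omega\mathbb{V}$, $\vec a\le_\mathcal{K}\vec b$ means there are orderly terms $f_j$ and finite subsequences $\vec b_j$ of $\vec b$ with $\vec a(j)=f_j(\bar b_j)$ for all $j\in\omega$ and $\vec b_0\ast\vec b_1\ast\cdots$ a subsequence of $\vec b$. $\mathrm{FR}_\mathcal{K}(\vec a)=\{f(\bar\tau):f\in\mathrm{OT}(\mathcal{K}),\ \vec\tau\text{ a finite subsequence of }\vec a\}$. $(\mathbb{V},\mathcal{K})$ is a Ramsey algebra if for every $\vec b\in{}^\omega\mathbb{V}$ and $X\subseteq\mathbb{V}$ there exists $\vec a\le_\mathcal{K}\vec b$ with $\mathrm{FR}_\mathcal{K}(\vec a)\subseteq X$ or $\mathrm{FR}_\mathcal{K}(\vec a)\cap X=\varnothing$. -}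

module Defs where

open import Level using (Level; _⊔_) renaming (suc to lsuc)
open import Data.Nat using (ℕ; zero; suc; _<_)
import Data.Nat as ℕ
open import Data.Fin using (Fin)
import Data.Fin as Fin
open import Data.Vec using (Vec; []; _∷_; take; drop; lookup; map; zipWith; replicate)
open import Data.Product using (Σ; _×_; _,_; ∃)
open import Data.Sum using (_⊎_)
open import Relation.Nullary using (¬_)
open import Relation.Unary using (Pred)
open import Relation.Binary.PropositionalEquality using (_≡_)
open import Algebra.Structures using (IsCommutativeRing)

record Field (c : Level) : Set (lsuc c) where
  field
    Carrier : Set c
    _+_     : Carrier → Carrier → Carrier
    _*_     : Carrier → Carrier → Carrier
    -_      : Carrier → Carrier
    0#      : Carrier
    1#      : Carrier
    isCommutativeRing : IsCommutativeRing _≡_ _+_ _*_ -_ 0# 1#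
    0≢1     : ¬ (0# ≡ 1#)
    inverse : ∀ x → ¬ (x ≡ 0#) → Σ Carrier λ y → x * y ≡ 1#

record Algebra (a i : Level) : Set (lsuc (a ⊔ i)) where
  field
    V     : Set a
    Op    : Set i                        -- index set of the operations in 𝒦
    arity : Op → ℕ
    op    : (g : Op) → Vec V (arity g) → V

module OrderlyTerms {a i : Level} (𝔸 : Algebra a i) where
  open Algebra 𝔸

  -- Orderly terms, indexed by their number of variables.
  -- 'var' is id_𝕍; 'app g hs' is g(h₁(x̄₁),…,h_k(x̄_k)) with consecutive
  -- disjoint variable blocks x̄₁,…,x̄_k whose concatenation is all variables.
  mutual
    data OT : ℕ → Set i where
      var : OT 1
      app : ∀ {m} (g : Op) → Args (arity g) m → OT m

    data Args : ℕ → ℕ → Set i where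
      []  : Args 0 0
      _∷_ : ∀ {n k m} → OT n → Args k m → Args (suc k) (n ℕ.+ m)

  mutual
    eval : ∀ {m} → OT m → Vec V m → V
    eval var (x ∷ []) = x
    eval (app g hs) xs = op g (evalArgs hs xs)

    evalArgs : ∀ {k m} → Args k m → Vec V m → Vec V k
    evalArgs [] xs = []
    evalArgs (_∷_ {n} h hs) xs = eval h (take n xs) ∷ evalArgs hs (drop n xs)

  -- strictly increasing index vectors (finite subsequences)
  Increasing : ∀ {m} → Vec ℕ m → Set
  Increasing {m} is = (p q : Fin m) → p Fin.< q → lookup is p < lookup is q

  FR : (ℕ → V) → Pred V (a ⊔ i)
  FR s x = Σ ℕ λ m → Σ (OT m) λ f → Σ (Vec ℕ m) λ is →
             Increasing is × eval f (map s is) ≡ x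

  -- a ≤_𝒦 b: a(j) = f_j(b̄_j), with b̄_j finite subsequences of b whose
  -- concatenation b̄₀ ∗ b̄₁ ∗ ⋯ is a subsequence of b
  _≤K_ : (ℕ → V) → (ℕ → V) → Set (a ⊔ i)
  s ≤K t = Σ (ℕ → ℕ) λ m → Σ ((j : ℕ) → OT (m j)) λ f →
             Σ ((j : ℕ) → Vec ℕ (m j)) λ is →
               (∀ j → Increasing (is j))
             × (∀ j j' → j < j' → (p : Fin (m j)) (q : Fin (m j')) →
                  lookup (is j) p < lookup (is j') q)
             × (∀ j → s j ≡ eval (f j) (map t (is j)))

-- (𝕍, 𝒦) is a Ramsey algebra (subsets X of 𝕍 taken as predicates at level ℓ)
IsRamseyAlgebra : ∀ {a i} (ℓ : Level) → Algebra a i → Set (a ⊔ i ⊔ lsuc ℓ)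
IsRamseyAlgebra ℓ 𝔸 =
  (b : ℕ → V) (X : Pred V ℓ) →
  Σ (ℕ → V) λ s → s ≤K b ×
    ((∀ x → FR s x → X x) ⊎ (∀ x → FR s x → ¬ X x))
  where open Algebra 𝔸
        open OrderlyTerms 𝔸

data VOp {c} (𝔽 : Field c) : Set c where
  plus  : VOp 𝔽
  scale : (r : Field.Carrier 𝔽) → ¬ (r ≡ Field.0# 𝔽) → VOp 𝔽

vectorAlgebra : ∀ {c} (𝔽 : Field c) (n : ℕ) → Algebra c c
vectorAlgebra 𝔽 n = record
  { V     = Vec F n
  ; Op    = VOp 𝔽
  ; arity = ar
  ; op    = opr
  }
  where
    open Field 𝔽 renaming (Carrier to F)
    ar : VOp 𝔽 → ℕ
    ar plus        = 2
    ar (scale _ _) = 1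
    opr : (g : VOp 𝔽) → Vec (Vec F n) (ar g) → Vec F n
    opr plus        (u ∷ v ∷ []) = zipWith _+_ u v
    opr (scale r _) (v ∷ [])     = map (r *_) v

module Submission where

-- Any n + 1 vectors of 𝔽ⁿ are linearly dependent, and a nontrivial vanishing combination
-- ∑ cⱼ · b(s + j) of a segment of b is the value of an orderly term: a sum of the nonzero
-- multiples cⱼ · b(s + j), applied to the subsequence of positions with cⱼ ≠ 0. Doing this on
-- the consecutive segments of length n + 1 shows that the constant sequence 0 is ≤_𝒦 every b.
-- Since every operation fixes 0, FR_𝒦 of that sequence is {0}, which lies inside or outside X.

open import Defs
open import Data.Nat using (ℕ)
open import Axiom.ExcludedMiddle using (ExcludedMiddle)

open import Level using (Level; _⊔_)
open import Data.Nat as ℕ using (zero; suc; _≤_; _<_; s≤s; z≤n)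
open import Data.Nat.Properties
  using (≤-refl; ≤-reflexive; ≤-trans; <⇒≤; <-≤-trans; *-monoˡ-≤; n≤1+n; m<m+n; +-suc)
  renaming (+-identityʳ to +ℕ-identityʳ; +-comm to +ℕ-comm)
open import Data.Fin using (Fin; zero; suc; toℕ; punchIn)
open import Data.Vec
  using (Vec; []; _∷_; _++_; take; drop; lookup; map; zipWith; replicate; tabulate)
open import Data.Vec.Properties using (map-++; lookup-zipWith; lookup-map; lookup-replicate;
  map-replicate; zipWith-replicate; tabulate∘lookup; tabulate-cong)
open import Data.Vec.Relation.Unary.All using (All; []; _∷_; universal)
open import Data.Vec.Relation.Unary.All.Properties using (map⁺; take⁺; drop⁺)
import Data.Vec.Functional as Vector
open import Data.Vec.Functional.Properties using (insertAt-lookup; insertAt-punchIn)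
open import Data.Product using (∃; _,_)
open import Data.Sum using (_⊎_; inj₁; inj₂; [_,_]′)
open import Data.Empty using (⊥-elim)
open import Relation.Nullary using (yes; no)
open import Relation.Nullary.Decidable using (decidable-stable)
open import Relation.Binary.PropositionalEquality
open import Algebra.Bundles using (CommutativeRing)
open import Function using (_∘_; const)

private variable
  ℓ : Level
  A : Set ℓ
  m k : ℕ

take-++ : ∀ (xs : Vec A m) (ys : Vec A k) → take m (xs ++ ys) ≡ xs
take-++ []       ys = refl
take-++ (x ∷ xs) ys = cong (x ∷_) (take-++ xs ys)

drop-++ : ∀ (xs : Vec A m) (ys : Vec A k) → drop m (xs ++ ys) ≡ ys
drop-++ []       ys = refl
drop-++ (x ∷ xs) ys = drop-++ xs ys

data AscendingIn : ℕ → ℕ → Vec ℕ m → Set where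
  []  : ∀ {lo hi} → lo ≤ hi → AscendingIn lo hi []
  _∷_ : ∀ {lo hi x} {xs : Vec ℕ m} → lo ≤ x → AscendingIn (suc x) hi xs → AscendingIn lo hi (x ∷ xs)

ascendingIn-lo≤hi : ∀ {lo hi} {xs : Vec ℕ m} → AscendingIn lo hi xs → lo ≤ hi
ascendingIn-lo≤hi ([] lo≤hi)    = lo≤hi
ascendingIn-lo≤hi (lo≤x ∷ asc) = ≤-trans lo≤x (<⇒≤ (ascendingIn-lo≤hi asc))

ascendingIn-lower : ∀ {lo hi} {xs : Vec ℕ m} → AscendingIn lo hi xs → ∀ p → lo ≤ lookup xs p
ascendingIn-lower (lo≤x ∷ asc) zero    = lo≤x
ascendingIn-lower (lo≤x ∷ asc) (suc p) = ≤-trans lo≤x (<⇒≤ (ascendingIn-lower asc p))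

ascendingIn-upper : ∀ {lo hi} {xs : Vec ℕ m} → AscendingIn lo hi xs → ∀ p → lookup xs p < hi
ascendingIn-upper (_ ∷ asc) zero    = ascendingIn-lo≤hi asc
ascendingIn-upper (_ ∷ asc) (suc p) = ascendingIn-upper asc p

ascendingIn-mono : ∀ {lo lo′ hi hi′} {xs : Vec ℕ m} →
  lo′ ≤ lo → hi ≤ hi′ → AscendingIn lo hi xs → AscendingIn lo′ hi′ xs
ascendingIn-mono lo′≤lo hi≤hi′ ([] lo≤hi)   = [] (≤-trans lo′≤lo (≤-trans lo≤hi hi≤hi′))
ascendingIn-mono lo′≤lo hi≤hi′ (lo≤x ∷ asc) =
  ≤-trans lo′≤lo lo≤x ∷ ascendingIn-mono ≤-refl hi≤hi′ asc

ascendingIn-++ : ∀ {lo mid hi} {xs : Vec ℕ m} {ys : Vec ℕ k} →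
  AscendingIn lo mid xs → AscendingIn mid hi ys → AscendingIn lo hi (xs ++ ys)
ascendingIn-++ ([] lo≤mid)    asc = ascendingIn-mono lo≤mid ≤-refl asc
ascendingIn-++ (lo≤x ∷ asc₁) asc₂ = lo≤x ∷ ascendingIn-++ asc₁ asc₂

module OrderlyValues {a i} (𝔸 : Algebra a i) where
  open Algebra 𝔸
  open OrderlyTerms 𝔸

  ascendingIn⇒increasing : ∀ {lo hi} {is : Vec ℕ m} → AscendingIn lo hi is → Increasing is
  ascendingIn⇒increasing (_ ∷ asc) zero    (suc q) _         = ascendingIn-lower asc q
  ascendingIn⇒increasing (_ ∷ asc) (suc p) (suc q) (s≤s p<q) = ascendingIn⇒increasing asc p q p<q

  record OrderlyValueIn (b : ℕ → V) (lo hi : ℕ) (x : V) : Set (a ⊔ i) where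
    field
      size      : ℕ
      term      : OT size
      indices   : Vec ℕ size
      ascending : AscendingIn lo hi indices
      value     : eval term (map b indices) ≡ x

  orderlyValueIn-mono : ∀ {b lo lo′ hi hi′ x} → lo′ ≤ lo → hi ≤ hi′ →
    OrderlyValueIn b lo hi x → OrderlyValueIn b lo′ hi′ x
  orderlyValueIn-mono lo′≤lo hi≤hi′ v = record
    { OrderlyValueIn v; ascending = ascendingIn-mono lo′≤lo hi≤hi′ (OrderlyValueIn.ascending v) }

  blocks⇒≤K : ∀ w {s b} → (∀ j → OrderlyValueIn b (j ℕ.* w) (suc j ℕ.* w) (s j)) → s ≤K b
  blocks⇒≤K w {s} {b} block =
    (λ j → size (block j)) , (λ j → term (block j)) , (λ j → indices (block j)) ,
    (λ j → ascendingIn⇒increasing (ascending (block j))) , separated ,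
    (λ j → sym (value (block j)))
    where
      open OrderlyValueIn
      separated : ∀ j j′ → j < j′ → (p : Fin (size (block j))) (q : Fin (size (block j′))) →
                  lookup (indices (block j)) p < lookup (indices (block j′)) q
      separated j j′ j<j′ p q = <-≤-trans (ascendingIn-upper (ascending (block j)) p)
        (≤-trans (*-monoˡ-≤ w j<j′) (ascendingIn-lower (ascending (block j′)) q))

  Idempotent : V → Set (a ⊔ i)
  Idempotent z = ∀ g (us : Vec V (arity g)) → All (_≡ z) us → op g us ≡ z

  module _ {z : V} (idem : Idempotent z) where
    mutual
      eval-idempotent : ∀ (f : OT m) (xs : Vec V m) → All (_≡ z) xs → eval f xs ≡ z
      eval-idempotent var        (x ∷ []) (x≡z ∷ []) = x≡z
      eval-idempotent (app g hs) xs       xs≡z       =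
        idem g (evalArgs hs xs) (evalArgs-idempotent hs xs xs≡z)

      evalArgs-idempotent : ∀ {n} (hs : Args n m) (xs : Vec V m) →
        All (_≡ z) xs → All (_≡ z) (evalArgs hs xs)
      evalArgs-idempotent []             xs xs≡z = []
      evalArgs-idempotent (_∷_ {n} h hs) xs xs≡z =
        eval-idempotent h (take n xs) (take⁺ n xs≡z) ∷
        evalArgs-idempotent hs (drop n xs) (drop⁺ n xs≡z)

    FR-const : ∀ {x} → FR (const z) x → z ≡ x
    FR-const (_ , f , is , _ , f≡x) =
      trans (sym (eval-idempotent f (map (const z) is) (map⁺ (universal (λ _ → refl) is)))) f≡x

    ramsey-from-idempotent : ExcludedMiddle ℓ → (∀ b → const z ≤K b) → IsRamseyAlgebra ℓ 𝔸
    ramsey-from-idempotent em z≤K b X with em {X z}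
    ... | yes z∈X = const z , z≤K b , inj₁ λ x fr → subst X (FR-const fr) z∈X
    ... | no  z∉X = const z , z≤K b , inj₂ λ x fr x∈X → z∉X (subst X (sym (FR-const fr)) x∈X)

module LinearDependence {c} (em : ExcludedMiddle c) (𝔽 : Field c) where

  commutativeRing : CommutativeRing c c
  commutativeRing = record { isCommutativeRing = Field.isCommutativeRing 𝔽 }

  open CommutativeRing commutativeRing public
    using (_+_; _*_; 0#; +-identityˡ; +-identityʳ; zeroˡ; zeroʳ) renaming (Carrier to F)
  open CommutativeRing commutativeRing
    using (-_; _-_; 1#; +-comm; *-comm; *-assoc; *-identityˡ; distribˡ; -‿inverseˡ;
           +-monoid; semiring; ring)
  open import Algebra.Properties.Monoid.Sum +-monoid public using (sum-syntax)
  open import Algebra.Properties.Semiring.Sum semiring public using (sum-cong-≗)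
  open import Algebra.Properties.Semiring.Sum semiring
    using (sum-replicate-zero; sum-remove; ∑-distrib-+; *-distribˡ-sum; *-distribʳ-sum)
  open import Algebra.Properties.Ring ring using (-‿distribˡ-*; -‿distribʳ-*)
  open ≡-Reasoning

  x*y≢0 : ∀ {x y} → x ≢ 0# → y ≢ 0# → x * y ≢ 0#
  x*y≢0 {x} {y} x≢0 y≢0 x*y≡0 with Field.inverse 𝔽 x x≢0
  ... | x⁻¹ , x*x⁻¹≡1 = y≢0 (begin
    y                ≡⟨ sym (*-identityˡ y) ⟩
    1# * y           ≡⟨ cong (_* y) (trans (sym x*x⁻¹≡1) (*-comm x x⁻¹)) ⟩
    (x⁻¹ * x) * y    ≡⟨ *-assoc x⁻¹ x y ⟩
    x⁻¹ * (x * y)    ≡⟨ cong (x⁻¹ *_) x*y≡0 ⟩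
    x⁻¹ * 0#         ≡⟨ zeroʳ x⁻¹ ⟩
    0#               ∎)

  record Dependence {m n} (v : Fin m → Fin n → F) : Set c where
    field
      coeff         : Fin m → F
      witness       : Fin m
      coeff≢0       : coeff witness ≢ 0#
      combination≡0 : ∀ k → ∑[ j < m ] (coeff j * v j k) ≡ 0#

  dependence-zeroColumn : ∀ {m n} {v : Fin (suc m) → Fin (suc n) → F} →
    (∀ j → v j zero ≡ 0#) → Dependence (λ j k → v (suc j) (suc k)) → Dependence v
  dependence-zeroColumn {m} {v = v} column≡0 dep = record
    { coeff         = 0# Vector.∷ coeff
    ; witness       = suc witness
    ; coeff≢0       = coeff≢0
    ; combination≡0 = λ where
        zero → begin
          0# * v zero zero + ∑[ j < m ] (coeff j * v (suc j) zero)
            ≡⟨ cong₂ _+_ (zeroˡ _) (sum-cong-≗ λ j →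
                 trans (cong (coeff j *_) (column≡0 (suc j))) (zeroʳ (coeff j))) ⟩
          0# + ∑[ j < m ] 0#  ≡⟨ +-identityˡ (∑[ j < m ] 0#) ⟩
          ∑[ j < m ] 0#       ≡⟨ sum-replicate-zero m ⟩
          0#                  ∎
        (suc k) → begin
          0# * v zero (suc k) + ∑[ j < m ] (coeff j * v (suc j) (suc k))
            ≡⟨ cong (_+ ∑[ j < m ] (coeff j * v (suc j) (suc k))) (zeroˡ (v zero (suc k))) ⟩
          0# + ∑[ j < m ] (coeff j * v (suc j) (suc k))
            ≡⟨ +-identityˡ _ ⟩
          ∑[ j < m ] (coeff j * v (suc j) (suc k))
            ≡⟨ combination≡0 k ⟩
          0# ∎
    }
    where open Dependence dep

  -- Gaussian elimination of the first column with pivot row p.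
  eliminate : ∀ {m n} → (Fin (suc m) → Fin (suc n) → F) → Fin (suc m) → Fin m → Fin n → F
  eliminate v p j k = v p zero * v (punchIn p j) (suc k) - v (punchIn p j) zero * v p (suc k)

  dependence-pivot : ∀ {m n} {v : Fin (suc m) → Fin (suc n) → F} (p : Fin (suc m)) →
    v p zero ≢ 0# → Dependence (eliminate v p) → Dependence v
  dependence-pivot {m} {v = v} p h≢0 dep = record
    { coeff         = coeff′
    ; witness       = punchIn p witness
    ; coeff≢0       = x*y≢0 h≢0 coeff≢0 ∘ trans (sym (insertAt-punchIn hcoeff p (- E) witness))
    ; combination≡0 = λ where
        zero → begin
          ∑[ j < suc m ] (coeff′ j * v j zero)       ≡⟨ split zero ⟩
          (- E) * h + ∑[ j < m ] (h * coeff j * a j) ≡⟨ cong ((- E) * h +_) h∑ ⟩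
          (- E) * h + h * E                          ≡⟨ cong₂ _+_ (sym (-‿distribˡ-* E h))
                                                                      (*-comm h E) ⟩
          - (E * h) + E * h                          ≡⟨ -‿inverseˡ (E * h) ⟩
          0#                                         ∎
        (suc k) → let B = v p (suc k); y = λ j → v (punchIn p j) (suc k)
                      T = ∑[ j < m ] (h * coeff j * y j) in begin
          ∑[ j < suc m ] (coeff′ j * v j (suc k))      ≡⟨ split (suc k) ⟩
          (- E) * B + T                                ≡⟨ +-comm _ T ⟩
          T + (- E) * B
            ≡⟨ cong (T +_) (trans (sym (-‿distribˡ-* E B)) (-‿distribʳ-* E B)) ⟩
          T + E * (- B)
            ≡⟨ cong (T +_) (*-distribʳ-sum (- B) λ j → coeff j * a j) ⟩
          T + ∑[ j < m ] (coeff j * a j * (- B))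
            ≡⟨ sym (∑-distrib-+ (λ j → h * coeff j * y j) λ j → coeff j * a j * (- B)) ⟩
          ∑[ j < m ] (h * coeff j * y j + coeff j * a j * (- B))
            ≡⟨ sum-cong-≗ (λ j → sym (expand (coeff j) (y j) (a j) B)) ⟩
          ∑[ j < m ] (coeff j * eliminate v p j k)     ≡⟨ combination≡0 k ⟩
          0#                                           ∎
    }
    where
      open Dependence dep
      h = v p zero
      a : Fin m → F
      a j = v (punchIn p j) zero
      E = ∑[ j < m ] (coeff j * a j)
      hcoeff : Fin m → F
      hcoeff j = h * coeff j
      coeff′ = Vector.insertAt hcoeff p (- E)
      split : ∀ k → ∑[ j < suc m ] (coeff′ j * v j k) ≡
                    (- E) * v p k + ∑[ j < m ] (h * coeff j * v (punchIn p j) k)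
      split k = trans (sum-remove {i = p} λ j → coeff′ j * v j k) (cong₂ _+_
        (cong (_* v p k) (insertAt-lookup hcoeff p (- E)))
        (sum-cong-≗ λ j → cong (_* v (punchIn p j) k) (insertAt-punchIn hcoeff p (- E) j)))
      h∑ : ∑[ j < m ] (h * coeff j * a j) ≡ h * E
      h∑ = trans (sum-cong-≗ λ j → *-assoc h (coeff j) (a j))
                 (sym (*-distribˡ-sum h λ j → coeff j * a j))
      expand : ∀ d y a B → d * (h * y - a * B) ≡ h * d * y + d * a * (- B)
      expand d y a B = begin
        d * (h * y - a * B)          ≡⟨ distribˡ d (h * y) (- (a * B)) ⟩
        d * (h * y) + d * - (a * B)
          ≡⟨ cong₂ _+_ (trans (sym (*-assoc d h y)) (cong (_* y) (*-comm d h)))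
                       (trans (sym (-‿distribʳ-* d (a * B))) (cong -_ (sym (*-assoc d a B)))) ⟩
        h * d * y + - (d * a * B)
          ≡⟨ cong (h * d * y +_) (-‿distribʳ-* (d * a) B) ⟩
        h * d * y + d * a * (- B)
          ∎

  dependence : ∀ {n} (v : Fin (suc n) → Fin n → F) → Dependence v
  dependence {zero} v = record
    { coeff = λ _ → 1# ; witness = zero ; coeff≢0 = Field.0≢1 𝔽 ∘ sym ; combination≡0 = λ () }
  dependence {suc n} v with em {∃ λ p → v p zero ≢ 0#}
  ... | yes (p , pivot≢0) = dependence-pivot p pivot≢0 (dependence (eliminate v p))
  ... | no noPivot = dependence-zeroColumn
          (λ j → decidable-stable em (λ v≢0 → noPivot (j , v≢0)))
          (dependence (λ j k → v (suc j) (suc k)))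

module VectorSpace {c} (em : ExcludedMiddle c) (𝔽 : Field c) (n : ℕ) where
  open LinearDependence em 𝔽
  𝕍 : Algebra c c
  𝕍 = vectorAlgebra 𝔽 n
  open Algebra 𝕍 using (V)
  open OrderlyTerms 𝕍
  open OrderlyValues 𝕍
  open ≡-Reasoning

  0ᵥ : V
  0ᵥ = replicate n 0#

  infixl 6 _+ᵥ_
  infixr 7 _·ᵥ_

  _+ᵥ_ : V → V → V
  _+ᵥ_ = zipWith _+_

  _·ᵥ_ : F → V → V
  r ·ᵥ u = map (r *_) u

  +ᵥ-identityʳ : ∀ {m} (u : Vec F m) → zipWith _+_ u (replicate m 0#) ≡ u
  +ᵥ-identityʳ []      = refl
  +ᵥ-identityʳ (x ∷ u) = cong₂ _∷_ (+-identityʳ x) (+ᵥ-identityʳ u)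

  0·ᵥ+ᵥ : ∀ {m} (u w : Vec F m) → zipWith _+_ (map (0# *_) u) w ≡ w
  0·ᵥ+ᵥ []      []      = refl
  0·ᵥ+ᵥ (x ∷ u) (y ∷ w) = cong₂ _∷_ (trans (cong (_+ y) (zeroˡ x)) (+-identityˡ y)) (0·ᵥ+ᵥ u w)

  ≗-lookup⇒≡ : ∀ {u w : V} → (∀ k → lookup u k ≡ lookup w k) → u ≡ w
  ≗-lookup⇒≡ {u} {w} u≗w = begin
    u                  ≡⟨ sym (tabulate∘lookup u) ⟩
    tabulate (lookup u) ≡⟨ tabulate-cong u≗w ⟩
    tabulate (lookup w) ≡⟨ tabulate∘lookup w ⟩
    w                  ∎

  0ᵥ-idempotent : Idempotent 0ᵥ
  0ᵥ-idempotent plus        (_ ∷ _ ∷ []) (refl ∷ refl ∷ []) =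
    trans (zipWith-replicate _+_ 0# 0#) (cong (replicate n) (+-identityʳ 0#))
  0ᵥ-idempotent (scale r _) (_ ∷ [])     (refl ∷ [])        =
    trans (map-replicate (r *_) 0# n) (cong (replicate n) (zeroʳ r))

  combination : (ℕ → V) → ℕ → ∀ {l} → (Fin l → F) → V
  combination b s {zero}  cf = 0ᵥ
  combination b s {suc l} cf = cf zero ·ᵥ b s +ᵥ combination b (suc s) (cf ∘ suc)

  lookup-combination : ∀ b s {l} (cf : Fin l → F) k →
    lookup (combination b s cf) k ≡ ∑[ j < l ] (cf j * lookup (b (s ℕ.+ toℕ j)) k)
  lookup-combination b s {zero}  cf k = lookup-replicate k 0#
  lookup-combination b s {suc l} cf k = begin
    lookup (cf zero ·ᵥ b s +ᵥ combination b (suc s) (cf ∘ suc)) k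
      ≡⟨ lookup-zipWith _+_ k (cf zero ·ᵥ b s) _ ⟩
    lookup (cf zero ·ᵥ b s) k + lookup (combination b (suc s) (cf ∘ suc)) k
      ≡⟨ cong₂ _+_ (lookup-map k (cf zero *_) (b s)) (lookup-combination b (suc s) (cf ∘ suc) k) ⟩
    cf zero * lookup (b s) k + ∑[ j < l ] (cf (suc j) * lookup (b (suc s ℕ.+ toℕ j)) k)
      ≡⟨ cong₂ _+_ (cong (λ t → cf zero * lookup (b t) k) (sym (+ℕ-identityʳ s)))
                   (sum-cong-≗ λ j →
                      cong (λ t → cf (suc j) * lookup (b t) k) (sym (+-suc s (toℕ j)))) ⟩
    ∑[ j < suc l ] (cf j * lookup (b (s ℕ.+ toℕ j)) k)
      ∎

  combination-zeroHead : ∀ b s {l} (cf : Fin (suc l) → F) → cf zero ≡ 0# →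
    combination b s cf ≡ combination b (suc s) (cf ∘ suc)
  combination-zeroHead b s cf c≡0 = begin
    cf zero ·ᵥ b s +ᵥ combination b (suc s) (cf ∘ suc)
      ≡⟨ cong (λ r → r ·ᵥ b s +ᵥ combination b (suc s) (cf ∘ suc)) c≡0 ⟩
    0# ·ᵥ b s +ᵥ combination b (suc s) (cf ∘ suc)
      ≡⟨ 0·ᵥ+ᵥ (b s) _ ⟩
    combination b (suc s) (cf ∘ suc)
      ∎

  combination-zeroCoeffs : ∀ b s {l} {cf : Fin l → F} →
    (∀ j → cf j ≡ 0#) → combination b s cf ≡ 0ᵥ
  combination-zeroCoeffs b s {zero}  cf≡0 = refl
  combination-zeroCoeffs b s {suc l} {cf} cf≡0 =
    trans (combination-zeroHead b s cf (cf≡0 zero)) (combination-zeroCoeffs b (suc s) (cf≡0 ∘ suc))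

  scaled : ∀ {b} {r} → r ≢ 0# → ∀ s → OrderlyValueIn b s (suc s) (r ·ᵥ b s)
  scaled {r = r} r≢0 s = record
    { size = 1; term = app (scale r r≢0) (var ∷ []); indices = s ∷ []
    ; ascending = ≤-refl ∷ [] ≤-refl; value = refl }

  _⊕_ : ∀ {b lo mid hi x y} → OrderlyValueIn b lo mid x → OrderlyValueIn b mid hi y →
        OrderlyValueIn b lo hi (x +ᵥ y)
  _⊕_ {b} u w = record
    { size      = size u ℕ.+ (size w ℕ.+ 0)
    ; term      = app plus (term u ∷ term w ∷ [])
    ; indices   = indices u ++ (indices w ++ [])
    ; ascending = ascendingIn-++ (ascending u) (ascendingIn-++ (ascending w) ([] ≤-refl))
    ; value     = cong₂ _+ᵥ_
        (trans (cong (eval (term u)) (take-map-++ (indices u) _)) (value u))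
        (trans (cong (eval (term w) ∘ take (size w)) (drop-map-++ (indices u) _))
               (trans (cong (eval (term w)) (take-map-++ (indices w) [])) (value w)))
    }
    where
      open OrderlyValueIn
      take-map-++ : ∀ {m k} (is : Vec ℕ m) (js : Vec ℕ k) → take m (map b (is ++ js)) ≡ map b is
      take-map-++ is js = trans (cong (take _) (map-++ b is js)) (take-++ (map b is) (map b js))
      drop-map-++ : ∀ {m k} (is : Vec ℕ m) (js : Vec ℕ k) → drop m (map b (is ++ js)) ≡ map b js
      drop-map-++ is js = trans (cong (drop _) (map-++ b is js)) (drop-++ (map b is) (map b js))

  combination-orderly : ∀ b s {l} (cf : Fin l → F) →
    (∀ j → cf j ≡ 0#) ⊎ OrderlyValueIn b s (s ℕ.+ l) (combination b s cf)
  combination-orderly b s {zero}  cf = inj₁ λ ()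
  combination-orderly b s {suc l} cf
    with em {cf zero ≡ 0#} | combination-orderly b (suc s) (cf ∘ suc)
  ... | yes c≡0 | inj₁ rest≡0 = inj₁ λ { zero → c≡0 ; (suc j) → rest≡0 j }
  ... | yes c≡0 | inj₂ rest   = inj₂ (subst (OrderlyValueIn b s (s ℕ.+ suc l))
    (sym (combination-zeroHead b s cf c≡0))
    (orderlyValueIn-mono (n≤1+n s) (≤-reflexive (sym (+-suc s l))) rest))
  ... | no  c≢0 | inj₁ rest≡0 = inj₂ (subst (OrderlyValueIn b s (s ℕ.+ suc l))
    (sym (trans (cong (cf zero ·ᵥ b s +ᵥ_) (combination-zeroCoeffs b (suc s) rest≡0))
                (+ᵥ-identityʳ _)))
    (orderlyValueIn-mono ≤-refl (m<m+n s (s≤s z≤n)) (scaled c≢0 s)))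
  ... | no  c≢0 | inj₂ rest   = inj₂
    (orderlyValueIn-mono ≤-refl (≤-reflexive (sym (+-suc s l))) (scaled c≢0 s ⊕ rest))

  0ᵥ-orderlyValueIn : ∀ b s → OrderlyValueIn b s (s ℕ.+ suc n) 0ᵥ
  0ᵥ-orderlyValueIn b s = [ (λ coeff≡0 → ⊥-elim (coeff≢0 (coeff≡0 witness)))
                  , subst (OrderlyValueIn b s (s ℕ.+ suc n)) combination≡0ᵥ
                  ]′ (combination-orderly b s coeff)
    where
      open Dependence (dependence λ j k → lookup (b (s ℕ.+ toℕ j)) k)
      combination≡0ᵥ : combination b s coeff ≡ 0ᵥ
      combination≡0ᵥ = ≗-lookup⇒≡ λ k →
        trans (lookup-combination b s coeff k)
              (trans (combination≡0 k) (sym (lookup-replicate k 0#)))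

  0ᵥ≤K : ∀ b → const 0ᵥ ≤K b
  0ᵥ≤K b = blocks⇒≤K (suc n) λ j →
    orderlyValueIn-mono ≤-refl (≤-reflexive (+ℕ-comm (j ℕ.* suc n) (suc n)))
                        (0ᵥ-orderlyValueIn b (j ℕ.* suc n))

theorem7p2 : ∀ {c} → ExcludedMiddle c → (𝔽 : Field c) (n : ℕ) →
    IsRamseyAlgebra c (vectorAlgebra 𝔽 n)
theorem7p2 em 𝔽 n = ramsey-from-idempotent 0ᵥ-idempotent em 0ᵥ≤K
  where
    open VectorSpace em 𝔽 n
    open OrderlyValues 𝕍
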